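{- For all sufficiently large $d$ the following holds. Let $v_0\in L_{d-1}$ and $h\in\mathrm{Hom}_{v_0}(Q^{\mathrm{mid}}_{2d-1})$ be such that $\frac12(h|_{L_d}+1)$ is a max-good and min-good legal labeling of $L_d$. Then $h|_{L_{d-1}}$ takes at most three values.
   Context: $Q^{\mathrm{mid}}_{2d-1}$ is the subgraph of the Hamming cube $\{0,1\}^{2d-1}$ induced on $L_{d-1}\cup L_d$ ($L_k$ = vectors with exactly $k$ ones); neighborhoods and distances are in this graph; $N^2(A)=N(N(A))$. $\mathrm{Hom}_{v_0}(\Gamma)$ is the set of $h:V(\Gamma)\to\mathbb{Z}$ with $h(v_0)=0$ and $|h(u)-h(v)|=1$ on every edge. A legal labeling of $L_d$ is $f:L_d\to\mathbb{Z}$ with $|f(u)-f(w)|\le1$ whenever $u,w\in L_d$, $\mathrm{dist}(u,w)=2$. For $A\subseteq L_d$, $[A]=\{v\in L_d:N(v)\subseteq N(A)\}$. $K$ is $2$-linked if any two of its vertices are joined by a sequence in $K$ with consecutive distances $\le2$. $K\subseteq L_d$ is a maximum (resp. minimum) component of $f$ if $K$ is $2$-linked and $f(y)<f(x)$ (resp. $f(y)>f(x)$) for all $x\in K$, $y\in N^2(K)\setminus K$. $f$ is max-good (resp. min-good) if there is no maximum (resp. minimum) component $K$ with $|K|\ge d/2$ and $|[K]|\le\frac{9}{10}\binom{2d-1}{d}$. -}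

module Defs where

open import Data.Nat using (ℕ; zero; suc; _+_; _*_; _∸_; _≤_; _≡ᵇ_)
open import Data.Nat.Combinatorics using (_C_)
open import Data.Bool using (Bool; true; false; _∧_; _∨_; not; if_then_else_)
open import Data.Vec using (Vec; []; _∷_)
open import Data.List using (List; []; _∷_; map; _++_; length; filterᵇ)
open import Data.Bool.ListAction using (any; all)
open import Data.Integer using (ℤ; ∣_∣; _-_; _<_) renaming (_≤_ to _≤ℤ_; _*_ to _*ℤ_; _+_ to _+ℤ_)
import Data.Integer as Z
open import Data.Product using (Σ; _×_; ∃)
open import Data.Sum using (_⊎_)
open import Relation.Binary.PropositionalEquality using (_≡_; _≢_)

dim : ℕ → ℕ
dim d = 2 * d ∸ 1

Cube : ℕ → Set
Cube n = Vec Bool n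

allVecs : (n : ℕ) → List (Cube n)
allVecs zero = [] ∷ []
allVecs (suc n) = map (true ∷_) (allVecs n) ++ map (false ∷_) (allVecs n)

weight : ∀ {n} → Cube n → ℕ
weight [] = 0
weight (true ∷ x) = suc (weight x)
weight (false ∷ x) = weight x

hd : ∀ {n} → Cube n → Cube n → ℕ
hd [] [] = 0
hd (a ∷ x) (b ∷ y) = (if (a ∧ not b) ∨ (b ∧ not a) then 1 else 0) + hd x y

inLd : (d : ℕ) → Cube (dim d) → Bool
inLd d x = weight x ≡ᵇ d

inLd-1 : (d : ℕ) → Cube (dim d) → Bool
inLd-1 d x = weight x ≡ᵇ (d ∸ 1)

isMid : (d : ℕ) → Cube (dim d) → Bool
isMid d x = inLd d x ∨ inLd-1 d x

adj : (d : ℕ) → Cube (dim d) → Cube (dim d) → Bool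
adj d x y = isMid d x ∧ isMid d y ∧ (hd x y ≡ᵇ 1)

Adj : (d : ℕ) → Cube (dim d) → Cube (dim d) → Set
Adj d x y = adj d x y ≡ true

-- Subsets of the vertex set (finite, hence given by Boolean predicates).
Subset : ℕ → Set
Subset d = Cube (dim d) → Bool

_∈_ : {X : Set} → X → (X → Bool) → Set
x ∈ A = A x ≡ true

N : (d : ℕ) → Subset d → Subset d
N d A x = any (λ y → A y ∧ adj d x y) (allVecs (dim d))

N² : (d : ℕ) → Subset d → Subset d
N² d A = N d (N d A)

card : (d : ℕ) → Subset d → ℕ
card d A = length (filterᵇ A (allVecs (dim d)))

closure : (d : ℕ) → Subset d → Subset d
closure d A v = inLd d v ∧ all (λ u → not (adj d v u) ∨ N d A u) (allVecs (dim d))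

Dist≤2 : (d : ℕ) → Cube (dim d) → Cube (dim d) → Set
Dist≤2 d x y = x ≡ y ⊎ Adj d x y ⊎ ∃ (λ z → Adj d x z × Adj d z y)

Dist2 : (d : ℕ) → Cube (dim d) → Cube (dim d) → Set
Dist2 d x y = x ≢ y × (Adj d x y → Data.Empty.⊥) × ∃ (λ z → Adj d x z × Adj d z y)
  where import Data.Empty

data Chain (d : ℕ) (K : Subset d) : Cube (dim d) → Cube (dim d) → Set where
  done : ∀ {x} → x ∈ K → Chain d K x x
  step : ∀ {x y z} → x ∈ K → Dist≤2 d x y → Chain d K y z → Chain d K x z

TwoLinked : (d : ℕ) → Subset d → Set
TwoLinked d K = ∀ x y → x ∈ K → y ∈ K → Chain d K x y

-- Homomorphisms Q^mid_{2d-1} → ℤ with h(v0) = 0 (values off the middle levels are irrelevant).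
IsHom : (d : ℕ) → Cube (dim d) → (Cube (dim d) → ℤ) → Set
IsHom d v0 h = h v0 ≡ Z.0ℤ × (∀ u v → Adj d u v → ∣ h u - h v ∣ ≡ 1)

-- Legal labeling of L_d (only values on L_d matter).
Legal : (d : ℕ) → (Cube (dim d) → ℤ) → Set
Legal d f = ∀ u w → u ∈ inLd d → w ∈ inLd d → Dist2 d u w → ∣ f u - f w ∣ ≤ 1

SubLd : (d : ℕ) → Subset d → Set
SubLd d K = ∀ x → x ∈ K → x ∈ inLd d

MaxComponent : (d : ℕ) → (Cube (dim d) → ℤ) → Subset d → Set
MaxComponent d f K = SubLd d K × TwoLinked d K ×
  (∀ x y → x ∈ K → y ∈ N² d K → K y ≡ false → f y < f x)

MinComponent : (d : ℕ) → (Cube (dim d) → ℤ) → Subset d → Set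
MinComponent d f K = SubLd d K × TwoLinked d K ×
  (∀ x y → x ∈ K → y ∈ N² d K → K y ≡ false → f x < f y)

Bad : (d : ℕ) → Subset d → Set
Bad d K = d ≤ 2 * card d K × 10 * card d (closure d K) ≤ 9 * (dim d C d)

MaxGood : (d : ℕ) → (Cube (dim d) → ℤ) → Set
MaxGood d f = ∀ K → MaxComponent d f K → Bad d K → Data.Empty.⊥
  where import Data.Empty

MinGood : (d : ℕ) → (Cube (dim d) → ℤ) → Set
MinGood d f = ∀ K → MinComponent d f K → Bad d K → Data.Empty.⊥
  where import Data.Empty

-- Since h changes by exactly 1 along edges and h = 2f - 1 on L_d, h is even on L_{d-1}, so it
-- suffices to show h v ≤ h u + 4 for all u, v ∈ L_{d-1}: then h takes only the values m, m + 2
-- and m + 4 on L_{d-1}, where m is its minimum there.  The 2-linked component K₁ of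
-- {x ∈ L_d : h x ≥ h v - 1} through an upper neighbour of v contains all d upper neighbours of v
-- and is a maximum component of f, so max-goodness forces |[K₁]| > (9/10)|L_d|.  The same
-- argument for -h and -f, using min-goodness, gives K₂ ⊆ {h ≤ h u + 1} with |[K₂]| > (9/10)|L_d|.
-- Hence [K₁] and [K₂] meet in some z; a lower neighbour w of z is adjacent to some x ∈ K₁ and
-- y ∈ K₂, and h v - 1 ≤ h x ≤ h w + 1 ≤ h y + 2 ≤ h u + 3.
module Submission where

open import Defs
open import Data.Bool using (Bool; true; false; _∧_; _∨_; not; T; T?)
open import Data.Bool.Properties using (T-≡)
open import Data.Nat using (ℕ; zero; suc; _≥_)
open import Data.Product using (Σ; ∃; _×_; _,_; proj₁; proj₂)
open import Data.Sum as Sum using (_⊎_; inj₁; inj₂)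
open import Function.Base using (_∘_)
open import Function.Bundles using (Equivalence)
open import Relation.Binary.PropositionalEquality
  using (_≡_; _≢_; refl; sym; trans; cong; cong₂; subst; subst₂; module ≡-Reasoning)
open import Relation.Nullary using (contradiction; yes; no)

module Combinatorics where

  open import Data.Bool.ListAction using (any; all)
  open import Data.Empty using (⊥-elim)
  open import Data.List using (List; []; _∷_; map; _++_; length; filterᵇ)
  open import Data.List.Properties using (length-++; filter-++; length-filter)
  open import Data.List.Membership.Propositional using (lose) renaming (_∈_ to _∈ˡ_)
  open import Data.List.Membership.Propositional.Properties using (∈-map⁺; ∈-++⁺ˡ; ∈-++⁺ʳ)
  open import Data.List.Relation.Unary.Any using (here; there; satisfied)
  import Data.List.Relation.Unary.Any.Properties as Any
  import Data.List.Relation.Unary.All as All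
  import Data.List.Relation.Unary.All.Properties as All
  open import Data.Nat using (_+_; _*_; _≤_; _<_; _≡ᵇ_; z≤n; s≤s; z<s; s<s⁻¹)
  open import Data.Nat.Combinatorics using (_C_; nCk+nC[k+1]≡[n+1]C[k+1])
  open import Data.Nat.Properties
    using ( _≟_; ≤-trans; ≤-<-trans; <-trans; <-irrefl; ≤∧≢⇒<; ≰⇒>; 1+n≰n; n<1+n; m≤n⇒m≤1+n
          ; m≤m+n; m≤n*m; +-monoˡ-≤; +-mono-<; *-distribˡ-+; *-cancelˡ-<; +-suc; +-comm
          ; +-identityʳ; +-cancelˡ-≡; suc-injective; 1+n≢n; ≡ᵇ⇒≡; ≡⇒≡ᵇ; module ≤-Reasoning)
  open import Data.Vec using ([]; _∷_)

  ∧-≡true⁺ : ∀ {a b} → a ≡ true → b ≡ true → a ∧ b ≡ true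
  ∧-≡true⁺ refl b≡true = b≡true

  ∧-≡true⁻ : ∀ {a b} → a ∧ b ≡ true → a ≡ true × b ≡ true
  ∧-≡true⁻ {true} b≡true = refl , b≡true

  ∨-≡true⁺ˡ : ∀ {a} b → a ≡ true → a ∨ b ≡ true
  ∨-≡true⁺ˡ _ refl = refl

  ∨-≡true⁺ʳ : ∀ a {b} → b ≡ true → a ∨ b ≡ true
  ∨-≡true⁺ʳ true  _      = refl
  ∨-≡true⁺ʳ false b≡true = b≡true

  ∨-≡true⁻ : ∀ {a b} → a ∨ b ≡ true → a ≡ true ⊎ b ≡ true
  ∨-≡true⁻ {true}  _      = inj₁ refl
  ∨-≡true⁻ {false} b≡true = inj₂ b≡true

  T⇒≡true : ∀ {b} → T b → b ≡ true
  T⇒≡true = Equivalence.to T-≡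

  ≡true⇒T : ∀ {b} → b ≡ true → T b
  ≡true⇒T = Equivalence.from T-≡

  _⊆_ : {X : Set} → (X → Bool) → (X → Bool) → Set
  A ⊆ B = ∀ {x} → x ∈ A → x ∈ B

  module _ {A : Set} where

    any-≡true⁺ : (p : A → Bool) {x : A} {xs : List A} → x ∈ˡ xs → x ∈ p → any p xs ≡ true
    any-≡true⁺ p x∈xs px = T⇒≡true (Any.any⁺ p (lose x∈xs (≡true⇒T px)))

    any-≡true⁻ : (p : A → Bool) (xs : List A) → any p xs ≡ true → ∃ λ x → x ∈ p
    any-≡true⁻ p xs any≡true with x , px ← satisfied (Any.any⁻ p xs (≡true⇒T any≡true))
      = x , T⇒≡true px

    all-≡true⁻ : (p : A → Bool) {x : A} (xs : List A) → all p xs ≡ true → x ∈ˡ xs → x ∈ p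
    all-≡true⁻ p xs all≡true x∈xs =
      T⇒≡true (All.lookup (All.all⁺ p xs (≡true⇒T all≡true)) x∈xs)

    count : (A → Bool) → List A → ℕ
    count p xs = length (filterᵇ p xs)

    count≤length : (p : A → Bool) (xs : List A) → count p xs ≤ length xs
    count≤length p = length-filter (λ x → T? (p x))

    count-++ : (p : A → Bool) (xs ys : List A) → count p (xs ++ ys) ≡ count p xs + count p ys
    count-++ p xs ys = trans (cong length (filter-++ _ xs ys)) (length-++ (filterᵇ p xs))

    count-const-false : (xs : List A) → count (λ _ → false) xs ≡ 0
    count-const-false []       = refl
    count-const-false (_ ∷ xs) = count-const-false xs

    module _ {p q : A → Bool} (p⊆q : p ⊆ q) where

      count-mono : (xs : List A) → count p xs ≤ count q xs
      count-mono []       = z≤n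
      count-mono (x ∷ xs) with p x in px | q x in qx
      ... | true  | true  = s≤s (count-mono xs)
      ... | true  | false = contradiction (trans (sym (p⊆q px)) qx) λ ()
      ... | false | true  = m≤n⇒m≤1+n (count-mono xs)
      ... | false | false = count-mono xs

      count-< : ∀ {x} (xs : List A) → x ∈ˡ xs → x ∈ q → p x ≡ false → count p xs < count q xs
      count-< (y ∷ xs) y∈xs qx px with p y in py | q y in qy | y∈xs
      ... | true  | false | _         = contradiction (trans (sym (p⊆q py)) qy) λ ()
      ... | true  | true  | here refl = contradiction (trans (sym py) px) λ ()
      ... | true  | true  | there x∈ = s≤s (count-< xs x∈ qx px)
      ... | false | true  | _         = s≤s (count-mono xs)
      ... | false | false | here refl = contradiction (trans (sym qy) qx) λ ()
      ... | false | false | there x∈ = count-< xs x∈ qx px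

      count-≡⇒⊇ : ∀ {x} (xs : List A) → count p xs ≡ count q xs → x ∈ˡ xs → x ∈ q → x ∈ p
      count-≡⇒⊇ {x} xs same x∈xs qx with p x in px
      ... | true  = refl
      ... | false = contradiction same (λ eq → <-irrefl eq (count-< xs x∈xs qx px))

    count-pigeonhole : {p q r : A → Bool} → p ⊆ r → q ⊆ r →
      (xs : List A) → count r xs < count p xs + count q xs → ∃ λ x → x ∈ p × x ∈ q
    count-pigeonhole {p} {q} {r} p⊆r q⊆r (x ∷ xs) r<p+q with p x in px | q x in qx | r x in rx
    ... | true  | true  | _     = x , px , qx
    ... | true  | false | true  = count-pigeonhole p⊆r q⊆r xs (s<s⁻¹ r<p+q)
    ... | false | true  | true  =
      count-pigeonhole p⊆r q⊆r xs (s<s⁻¹ (subst (suc (count r xs) <_) (+-suc (count p xs) (count q xs)) r<p+q))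
    ... | false | false | true  = count-pigeonhole p⊆r q⊆r xs (<-trans (n<1+n _) r<p+q)
    ... | false | false | false = count-pigeonhole p⊆r q⊆r xs r<p+q
    ... | true  | _     | false = contradiction (trans (sym (p⊆r px)) rx) λ ()
    ... | false | true  | false = contradiction (trans (sym (q⊆r qx)) rx) λ ()

  count-map : {A B : Set} (p : B → Bool) (g : A → B) (xs : List A) →
    count p (map g xs) ≡ count (λ x → p (g x)) xs
  count-map p g []       = refl
  count-map p g (x ∷ xs) with p (g x)
  ... | true  = cong suc (count-map p g xs)
  ... | false = count-map p g xs

  nine-tenths-twice : ∀ n a b → 9 * n < 10 * a → 9 * n < 10 * b → n < a + b
  nine-tenths-twice n a b 9n<10a 9n<10b = *-cancelˡ-< 10 n (a + b) (begin-strict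
    10 * n          ≤⟨ +-monoˡ-≤ (9 * n) (m≤n*m n 9) ⟩
    9 * n + 9 * n   <⟨ +-mono-< 9n<10a 9n<10b ⟩
    10 * a + 10 * b ≡⟨ *-distribˡ-+ 10 a b ⟨
    10 * (a + b)    ∎)
    where open ≤-Reasoning

  -- The Boolean cube

  allVecs-complete : ∀ {n} (x : Cube n) → x ∈ˡ allVecs n
  allVecs-complete []          = here refl
  allVecs-complete (true ∷ x)  = ∈-++⁺ˡ (∈-map⁺ (true ∷_) (allVecs-complete x))
  allVecs-complete (false ∷ x) = ∈-++⁺ʳ _ (∈-map⁺ (false ∷_) (allVecs-complete x))

  count-allVecs-suc : ∀ {n} (p : Cube (suc n) → Bool) →
    count p (allVecs (suc n)) ≡ count (λ x → p (true ∷ x)) (allVecs n) + count (λ x → p (false ∷ x)) (allVecs n)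
  count-allVecs-suc {n} p = trans (count-++ p (map (true ∷_) (allVecs n)) (map (false ∷_) (allVecs n)))
    (cong₂ _+_ (count-map p (true ∷_) (allVecs n)) (count-map p (false ∷_) (allVecs n)))

  count-weight≡ : ∀ n k → count (λ x → weight x ≡ᵇ k) (allVecs n) ≡ n C k
  count-weight≡ zero    zero    = refl
  count-weight≡ zero    (suc k) = refl
  count-weight≡ (suc n) zero
    rewrite count-allVecs-suc {n} (λ x → weight x ≡ᵇ 0) | count-const-false (allVecs n) = count-weight≡ n 0
  count-weight≡ (suc n) (suc k)
    rewrite count-allVecs-suc {n} (λ x → weight x ≡ᵇ suc k) | count-weight≡ n k | count-weight≡ n (suc k)
    = nCk+nC[k+1]≡[n+1]C[k+1] n k

  infix 5 _==_ _⋖ᵇ_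
  infix 4 _⋖_

  _==_ : ∀ {n} → Cube n → Cube n → Bool
  []          == []          = true
  (true ∷ x)  == (true ∷ y)  = x == y
  (false ∷ x) == (false ∷ y) = x == y
  (true ∷ x)  == (false ∷ y) = false
  (false ∷ x) == (true ∷ y)  = false

  ==-refl : ∀ {n} (x : Cube n) → x == x ≡ true
  ==-refl []          = refl
  ==-refl (true ∷ x)  = ==-refl x
  ==-refl (false ∷ x) = ==-refl x

  ==⇒≡ : ∀ {n} (x y : Cube n) → x == y ≡ true → x ≡ y
  ==⇒≡ []          []          _  = refl
  ==⇒≡ (true ∷ x)  (true ∷ y)  eq = cong (true ∷_) (==⇒≡ x y eq)
  ==⇒≡ (false ∷ x) (false ∷ y) eq = cong (false ∷_) (==⇒≡ x y eq)

  count-== : ∀ {n} (x : Cube n) → count (x ==_) (allVecs n) ≡ 1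
  count-== []                = refl
  count-== {suc n} (true ∷ x)
    rewrite count-allVecs-suc ((true ∷ x) ==_) | count-== x | count-const-false (allVecs n) = refl
  count-== {suc n} (false ∷ x)
    rewrite count-allVecs-suc ((false ∷ x) ==_) | count-== x | count-const-false (allVecs n) = refl

  _⋖ᵇ_ : ∀ {n} → Cube n → Cube n → Bool
  []          ⋖ᵇ []          = false
  (false ∷ v) ⋖ᵇ (true ∷ x)  = v == x
  (true ∷ v)  ⋖ᵇ (false ∷ x) = false
  (false ∷ v) ⋖ᵇ (false ∷ x) = v ⋖ᵇ x
  (true ∷ v)  ⋖ᵇ (true ∷ x)  = v ⋖ᵇ x

  _⋖_ : ∀ {n} → Cube n → Cube n → Set
  v ⋖ x = v ⋖ᵇ x ≡ true

  zeros : ∀ {n} → Cube n → ℕ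
  zeros []          = 0
  zeros (true ∷ x)  = zeros x
  zeros (false ∷ x) = suc (zeros x)

  weight+zeros≡n : ∀ {n} (x : Cube n) → weight x + zeros x ≡ n
  weight+zeros≡n []          = refl
  weight+zeros≡n (true ∷ x)  = cong suc (weight+zeros≡n x)
  weight+zeros≡n (false ∷ x) = trans (+-suc (weight x) (zeros x)) (cong suc (weight+zeros≡n x))

  count-⋖ : ∀ {n} (v : Cube n) → count (v ⋖ᵇ_) (allVecs n) ≡ zeros v
  count-⋖ []                = refl
  count-⋖ {suc n} (true ∷ v)
    rewrite count-allVecs-suc ((true ∷ v) ⋖ᵇ_) | count-⋖ v | count-const-false (allVecs n) = +-comm (zeros v) 0
  count-⋖ {suc n} (false ∷ v)
    rewrite count-allVecs-suc ((false ∷ v) ⋖ᵇ_) | count-== v | count-⋖ v = refl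

  upper-cover : ∀ {n} (v : Cube n) → 0 < zeros v → ∃ λ x → v ⋖ x
  upper-cover (false ∷ v) _      = true ∷ v , ==-refl v
  upper-cover (true ∷ v)  zeros>0 with x , v⋖x ← upper-cover v zeros>0 = true ∷ x , v⋖x

  lower-cover : ∀ {n} (x : Cube n) → 0 < weight x → ∃ λ v → v ⋖ x
  lower-cover (true ∷ x)  _       = false ∷ x , ==-refl x
  lower-cover (false ∷ x) weight>0 with v , v⋖x ← lower-cover x weight>0 = false ∷ v , v⋖x

  hd-refl : ∀ {n} (x : Cube n) → hd x x ≡ 0
  hd-refl []          = refl
  hd-refl (true ∷ x)  = hd-refl x
  hd-refl (false ∷ x) = hd-refl x

  hd-sym : ∀ {n} (x y : Cube n) → hd x y ≡ hd y x
  hd-sym []          []          = refl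
  hd-sym (true ∷ x)  (true ∷ y)  = hd-sym x y
  hd-sym (false ∷ x) (false ∷ y) = hd-sym x y
  hd-sym (true ∷ x)  (false ∷ y) = cong suc (hd-sym x y)
  hd-sym (false ∷ x) (true ∷ y)  = cong suc (hd-sym x y)

  hd≡0⇒≡ : ∀ {n} (x y : Cube n) → hd x y ≡ 0 → x ≡ y
  hd≡0⇒≡ []          []          _  = refl
  hd≡0⇒≡ (true ∷ x)  (true ∷ y)  eq = cong (true ∷_) (hd≡0⇒≡ x y eq)
  hd≡0⇒≡ (false ∷ x) (false ∷ y) eq = cong (false ∷_) (hd≡0⇒≡ x y eq)

  hd≡1⇒weight≢ : ∀ {n} (x y : Cube n) → hd x y ≡ 1 → weight x ≢ weight y
  hd≡1⇒weight≢ []          []          ()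
  hd≡1⇒weight≢ (true ∷ x)  (true ∷ y)  hd≡1 = hd≡1⇒weight≢ x y hd≡1 ∘ suc-injective
  hd≡1⇒weight≢ (false ∷ x) (false ∷ y) hd≡1 = hd≡1⇒weight≢ x y hd≡1
  hd≡1⇒weight≢ (true ∷ x)  (false ∷ y) hd≡1 rewrite hd≡0⇒≡ x y (suc-injective hd≡1) = 1+n≢n
  hd≡1⇒weight≢ (false ∷ x) (true ∷ y)  hd≡1 rewrite hd≡0⇒≡ x y (suc-injective hd≡1) = 1+n≢n ∘ sym

  ⋖⇒weight : ∀ {n} (v x : Cube n) → v ⋖ x → weight x ≡ suc (weight v)
  ⋖⇒weight []          []          ()
  ⋖⇒weight (false ∷ v) (true ∷ x)  v⋖x = cong (suc ∘ weight) (sym (==⇒≡ v x v⋖x))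
  ⋖⇒weight (false ∷ v) (false ∷ x) v⋖x = ⋖⇒weight v x v⋖x
  ⋖⇒weight (true ∷ v)  (true ∷ x)  v⋖x = cong suc (⋖⇒weight v x v⋖x)

  ⋖⇒hd≡1 : ∀ {n} (v x : Cube n) → v ⋖ x → hd v x ≡ 1
  ⋖⇒hd≡1 []          []          ()
  ⋖⇒hd≡1 (false ∷ v) (true ∷ x)  v⋖x = cong suc (subst (λ u → hd u x ≡ 0) (sym (==⇒≡ v x v⋖x)) (hd-refl x))
  ⋖⇒hd≡1 (false ∷ v) (false ∷ x) v⋖x = ⋖⇒hd≡1 v x v⋖x
  ⋖⇒hd≡1 (true ∷ v)  (true ∷ x)  v⋖x = ⋖⇒hd≡1 v x v⋖x

  ≡ᵇ-≡true⇒≡ : ∀ {m n} → (m ≡ᵇ n) ≡ true → m ≡ n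
  ≡ᵇ-≡true⇒≡ {m} {n} eq = ≡ᵇ⇒≡ m n (≡true⇒T eq)

  ≡⇒≡ᵇ-≡true : ∀ {m n} → m ≡ n → (m ≡ᵇ n) ≡ true
  ≡⇒≡ᵇ-≡true {m} {n} eq = T⇒≡true (≡⇒≡ᵇ m n eq)

  -- The middle levels graph and its 2-linked components

  module MiddleLevels (d : ℕ) where

    Adj-sym : ∀ x y → Adj d x y → Adj d y x
    Adj-sym x y x~y with isMid d x | isMid d y | x~y
    ... | true | true | hd≡1 = trans (cong (_≡ᵇ 1) (hd-sym y x)) hd≡1

    Adj⇒isMid : ∀ x y → Adj d x y → y ∈ isMid d
    Adj⇒isMid x y x~y = proj₁ (∧-≡true⁻ (proj₂ (∧-≡true⁻ {isMid d x} x~y)))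

    Adj⇒weight≢ : ∀ x y → Adj d x y → weight x ≢ weight y
    Adj⇒weight≢ x y x~y =
      hd≡1⇒weight≢ x y (≡ᵇ-≡true⇒≡ (proj₂ (∧-≡true⁻ (proj₂ (∧-≡true⁻ {isMid d x} x~y)))))

    Ld-Adj⇒Ld-1 : ∀ x y → x ∈ inLd d → Adj d x y → y ∈ inLd-1 d
    Ld-Adj⇒Ld-1 x y x∈ x~y with ∨-≡true⁻ (Adj⇒isMid x y x~y)
    ... | inj₁ y∈ = contradiction (trans (≡ᵇ-≡true⇒≡ x∈) (sym (≡ᵇ-≡true⇒≡ y∈))) (Adj⇒weight≢ x y x~y)
    ... | inj₂ y∈ = y∈

    Ld-1-Adj⇒Ld : ∀ x y → x ∈ inLd-1 d → Adj d x y → y ∈ inLd d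
    Ld-1-Adj⇒Ld x y x∈ x~y with ∨-≡true⁻ (Adj⇒isMid x y x~y)
    ... | inj₁ y∈ = y∈
    ... | inj₂ y∈ = contradiction (trans (≡ᵇ-≡true⇒≡ x∈) (sym (≡ᵇ-≡true⇒≡ y∈))) (Adj⇒weight≢ x y x~y)

    N⁺ : ∀ A x y → y ∈ A → Adj d x y → x ∈ N d A
    N⁺ A x y y∈A x~y = any-≡true⁺ _ (allVecs-complete y) (∧-≡true⁺ y∈A x~y)

    N⁻ : ∀ A x → x ∈ N d A → ∃ λ y → y ∈ A × Adj d x y
    N⁻ A x x∈NA with y , y∈ ← any-≡true⁻ (λ y → A y ∧ adj d x y) (allVecs (dim d)) x∈NA = y , ∧-≡true⁻ y∈

    N²⁺ : ∀ A x w y → y ∈ A → Adj d w y → Adj d x w → x ∈ N² d A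
    N²⁺ A x w y y∈A w~y x~w = N⁺ (N d A) x w (N⁺ A w y y∈A w~y) x~w

    N²-Ld : ∀ {K} → K ⊆ inLd d → N² d K ⊆ inLd d
    N²-Ld {K} K⊆Ld {y} y∈N²K =
      let w , w∈NK , y~w = N⁻ (N d K) y y∈N²K
          x , x∈K , w~x = N⁻ K w w∈NK
      in Ld-1-Adj⇒Ld w y (Ld-Adj⇒Ld-1 x w (K⊆Ld x∈K) (Adj-sym w x w~x)) (Adj-sym y w y~w)

    closure⁻ : ∀ A z → z ∈ closure d A → z ∈ inLd d × (∀ w → Adj d z w → w ∈ N d A)
    closure⁻ A z z∈[A] with z∈Ld , all≡true ← ∧-≡true⁻ z∈[A] = z∈Ld , λ w z~w →
      subst (λ b → not b ∨ N d A w ≡ true) z~w (all-≡true⁻ _ _ all≡true (allVecs-complete w))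

    HasLargeClosure : Subset d → Set
    HasLargeClosure K = 9 * (dim d C d) < 10 * card d (closure d K)

    MaxGood⇒HasLargeClosure : ∀ {f K} → MaxGood d f → MaxComponent d f K → d ≤ 2 * card d K →
      HasLargeClosure K
    MaxGood⇒HasLargeClosure {K = K} maxGood isMax half = ≰⇒> λ small → maxGood K isMax (half , small)

    large-closures-meet : ∀ A B → HasLargeClosure A → HasLargeClosure B →
      ∃ λ z → z ∈ closure d A × z ∈ closure d B
    large-closures-meet A B large-A large-B =
      count-pigeonhole (λ {z} → proj₁ ∘ closure⁻ A z) (λ {z} → proj₁ ∘ closure⁻ B z) (allVecs (dim d))
        |Ld|<|[A]|+|[B]|
      where
        |Ld|<|[A]|+|[B]| : card d (inLd d) < card d (closure d A) + card d (closure d B)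
        |Ld|<|[A]|+|[B]| = subst (_< card d (closure d A) + card d (closure d B)) (sym (count-weight≡ (dim d) d))
          (nine-tenths-twice _ (card d (closure d A)) (card d (closure d B)) large-A large-B)

    Dist≤2-sym : ∀ x y → Dist≤2 d x y → Dist≤2 d y x
    Dist≤2-sym x y (inj₁ x≡y)                   = inj₁ (sym x≡y)
    Dist≤2-sym x y (inj₂ (inj₁ x~y))            = inj₂ (inj₁ (Adj-sym x y x~y))
    Dist≤2-sym x y (inj₂ (inj₂ (z , x~z , z~y))) = inj₂ (inj₂ (z , Adj-sym z y z~y , Adj-sym x z x~z))

    Chain-mono : ∀ {K K′ x y} → K ⊆ K′ → Chain d K x y → Chain d K′ x y
    Chain-mono K⊆K′ (done x∈)          = done (K⊆K′ x∈)
    Chain-mono K⊆K′ (step x∈ x~y y→z) = step (K⊆K′ x∈) x~y (Chain-mono K⊆K′ y→z)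

    module _ {K : Subset d} where

      Chain-snoc : ∀ {x y z} → Chain d K x y → z ∈ K → Dist≤2 d y z → Chain d K x z
      Chain-snoc (done x∈)          z∈ y~z = step x∈ y~z (done z∈)
      Chain-snoc (step x∈ x~y y→z) w∈ z~w = step x∈ x~y (Chain-snoc y→z w∈ z~w)

      Chain-reverse : ∀ {x y} → Chain d K x y → Chain d K y x
      Chain-reverse (done x∈)          = done x∈
      Chain-reverse (step {x} {y} x∈ x~y y→z) = Chain-snoc (Chain-reverse y→z) x∈ (Dist≤2-sym x y x~y)

      Chain-++ : ∀ {x y z} → Chain d K x y → Chain d K y z → Chain d K x z
      Chain-++ (done _)           y→z = y→z
      Chain-++ (step x∈ x~w w→y) y→z = step x∈ x~w (Chain-++ w→y y→z)

      TwoLinked-from : ∀ b → (∀ {x} → x ∈ K → Chain d K b x) → TwoLinked d K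
      TwoLinked-from b chain x y x∈ y∈ = Chain-++ (Chain-reverse (chain x∈)) (chain y∈)

    record Component (T : Subset d) (b : Cube (dim d)) : Set where
      field
        K        : Subset d
        b∈K      : b ∈ K
        K⊆T      : K ⊆ T
        K-linked : TwoLinked d K
        K-closed : ∀ {y} → y ∈ N² d K → y ∈ T → y ∈ K

    module _ (T : Subset d) (b : Cube (dim d)) (b∈T : b ∈ T) where

      private
        grow : Subset d → Subset d
        grow R x = R x ∨ (T x ∧ N² d R x)

        reach : ℕ → Subset d
        reach zero    = b ==_
        reach (suc k) = grow (reach k)

        Closed : Subset d → Set
        Closed R = ∀ {y} → y ∈ N² d R → y ∈ T → y ∈ R

        reach-suc : ∀ k → reach k ⊆ reach (suc k)
        reach-suc k = ∨-≡true⁺ˡ _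

        b∈reach : ∀ k → b ∈ reach k
        b∈reach zero    = ==-refl b
        b∈reach (suc k) = reach-suc k (b∈reach k)

        reach⊆T : ∀ k → reach k ⊆ T
        reach⊆T zero    {x} b==x = subst (_∈ T) (==⇒≡ b x b==x) b∈T
        reach⊆T (suc k) x∈ with ∨-≡true⁻ x∈
        ... | inj₁ x∈reach = reach⊆T k x∈reach
        ... | inj₂ x∈T∩N² = proj₁ (∧-≡true⁻ x∈T∩N²)

        reach-chain : ∀ k {x} → x ∈ reach k → Chain d (reach k) b x
        reach-chain zero    {x} b==x = subst (Chain d (reach 0) b) (==⇒≡ b x b==x) (done (==-refl b))
        reach-chain (suc k) {x} x∈ with ∨-≡true⁻ x∈
        ... | inj₁ x∈reach = Chain-mono (reach-suc k) (reach-chain k x∈reach)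
        ... | inj₂ x∈T∩N² =
          let w , w∈N , x~w = N⁻ (N d (reach k)) x (proj₂ (∧-≡true⁻ x∈T∩N²))
              r , r∈  , w~r = N⁻ (reach k) w w∈N
          in Chain-snoc (Chain-mono (reach-suc k) (reach-chain k r∈)) x∈
               (inj₂ (inj₂ (w , Adj-sym w r w~r , Adj-sym x w x~w)))

        saturates : ∀ k → k ≤ card d (reach k) ⊎ ∃ λ j → Closed (reach j)
        saturates zero = inj₁ z≤n
        saturates (suc k) with saturates k
        ... | inj₂ closed = inj₂ closed
        ... | inj₁ k≤card with card d (reach k) ≟ card d (reach (suc k))
        ...   | yes same = inj₂ (k , λ {y} y∈N² y∈T → count-≡⇒⊇ (reach-suc k) (allVecs (dim d)) same
                  (allVecs-complete y) (∨-≡true⁺ʳ (reach k y) (∧-≡true⁺ y∈T y∈N²)))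
        ...   | no differ =
                  inj₁ (≤-<-trans k≤card (≤∧≢⇒< (count-mono (reach-suc k) (allVecs (dim d))) differ))

        saturated : ∃ λ j → Closed (reach j)
        saturated with saturates (suc (length (allVecs (dim d))))
        ... | inj₁ too-big = ⊥-elim (1+n≰n (≤-trans too-big (count≤length _ (allVecs (dim d)))))
        ... | inj₂ closed  = closed

      component : Component T b
      component with j , closed ← saturated = record
        { K        = reach j
        ; b∈K      = b∈reach j
        ; K⊆T      = reach⊆T j
        ; K-linked = TwoLinked-from b (reach-chain j)
        ; K-closed = closed
        }

  module Covers (d : ℕ) where

    open MiddleLevels (suc d)

    ⋖-Ld-1⇒Ld : ∀ v x → v ∈ inLd-1 (suc d) → v ⋖ x → x ∈ inLd (suc d)
    ⋖-Ld-1⇒Ld v x v∈ v⋖x = ≡⇒≡ᵇ-≡true (trans (⋖⇒weight v x v⋖x) (cong suc (≡ᵇ-≡true⇒≡ v∈)))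

    ⋖-Ld⇒Ld-1 : ∀ v x → x ∈ inLd (suc d) → v ⋖ x → v ∈ inLd-1 (suc d)
    ⋖-Ld⇒Ld-1 v x x∈ v⋖x = ≡⇒≡ᵇ-≡true (suc-injective (trans (sym (⋖⇒weight v x v⋖x)) (≡ᵇ-≡true⇒≡ x∈)))

    ⋖⇒Adj : ∀ v x → v ∈ inLd-1 (suc d) → x ∈ inLd (suc d) → v ⋖ x → Adj (suc d) v x
    ⋖⇒Adj v x v∈ x∈ v⋖x =
      ∧-≡true⁺ (∨-≡true⁺ʳ (inLd (suc d) v) v∈) (∧-≡true⁺ (∨-≡true⁺ˡ _ x∈) (≡⇒≡ᵇ-≡true (⋖⇒hd≡1 v x v⋖x)))

    zeros-Ld-1 : ∀ v → v ∈ inLd-1 (suc d) → zeros v ≡ suc d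
    zeros-Ld-1 v v∈ = +-cancelˡ-≡ d _ _ (begin
      d + zeros v        ≡⟨ cong (_+ zeros v) (≡ᵇ-≡true⇒≡ v∈) ⟨
      weight v + zeros v ≡⟨ weight+zeros≡n v ⟩
      d + suc (d + 0)    ≡⟨ cong (λ m → d + suc m) (+-identityʳ d) ⟩
      d + suc d          ∎)
      where open ≡-Reasoning

    upper-covers-Ld-1 : ∀ v → v ∈ inLd-1 (suc d) → count (v ⋖ᵇ_) (allVecs (dim (suc d))) ≡ suc d
    upper-covers-Ld-1 v v∈ = trans (count-⋖ v) (zeros-Ld-1 v v∈)

    upper-cover-Ld-1 : ∀ v → v ∈ inLd-1 (suc d) → ∃ λ x → v ⋖ x
    upper-cover-Ld-1 v v∈ = upper-cover v (subst (0 <_) (sym (zeros-Ld-1 v v∈)) z<s)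

    lower-cover-Ld : ∀ x → x ∈ inLd (suc d) → ∃ λ v → v ⋖ x
    lower-cover-Ld x x∈ = lower-cover x (subst (0 <_) (sym (≡ᵇ-≡true⇒≡ x∈)) z<s)

    closures-meet⇒neighbourhoods-meet : ∀ A B z → z ∈ closure (suc d) A → z ∈ closure (suc d) B →
      ∃ λ w → w ∈ N (suc d) A × w ∈ N (suc d) B
    closures-meet⇒neighbourhoods-meet A B z z∈[A] z∈[B] =
      let z∈Ld , N[z]⊆N[A] = closure⁻ A z z∈[A]
          w , w⋖z = lower-cover-Ld z z∈Ld
          z~w = Adj-sym w z (⋖⇒Adj w z (⋖-Ld⇒Ld-1 w z z∈Ld w⋖z) z∈Ld w⋖z)
      in w , N[z]⊆N[A] w z~w , proj₂ (closure⁻ B z z∈[B]) w z~w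

    upper-covers⊆⇒half : ∀ v K → v ∈ inLd-1 (suc d) → (v ⋖ᵇ_) ⊆ K → suc d ≤ 2 * card (suc d) K
    upper-covers⊆⇒half v K v∈ covers⊆K =
      ≤-trans (subst (_≤ card (suc d) K) (upper-covers-Ld-1 v v∈) (count-mono covers⊆K (allVecs (dim (suc d)))))
              (m≤m+n _ _)

open Combinatorics

open import Data.Integer
  using (ℤ; +_; -[1+_]; _+_; _-_; -_; _*_; ∣_∣; _≤_; _<_; _≤ᵇ_; 1ℤ) renaming (suc to sucℤ)
import Data.Integer.Properties as Int
open import Data.Integer.Tactic.RingSolver using (solve-∀)
open import Data.List using (filterᵇ)
open import Data.List.Extrema Int.≤-totalOrder using (argmin; f[argmin]≤f[xs]; argmin-all)
open import Data.List.Membership.Propositional.Properties using (∈-filter⁺)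
import Data.List.Relation.Unary.All as All
open import Data.List.Relation.Unary.All.Properties using (all-filter)

∣i-j∣≡1⇒i≡j±1 : ∀ {i j} → ∣ i - j ∣ ≡ 1 → i ≡ j + 1ℤ ⊎ i ≡ j - 1ℤ
∣i-j∣≡1⇒i≡j±1 {i} {j} = by-sign (i - j) (i≡j+[i-j] i j)
  where
    i≡j+[i-j] : ∀ i j → i ≡ j + (i - j)
    i≡j+[i-j] = solve-∀
    by-sign : ∀ k → i ≡ j + k → ∣ k ∣ ≡ 1 → i ≡ j + 1ℤ ⊎ i ≡ j - 1ℤ
    by-sign (+ _)    i≡j+k refl = inj₁ i≡j+k
    by-sign -[1+ _ ] i≡j+k refl = inj₂ i≡j+k

∣i-j∣≡1⇒i≤j+1 : ∀ {i j} → ∣ i - j ∣ ≡ 1 → i ≤ j + 1ℤ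
∣i-j∣≡1⇒i≤j+1 {i} {j} ∣i-j∣≡1 with ∣i-j∣≡1⇒i≡j±1 {i} {j} ∣i-j∣≡1
... | inj₁ refl = Int.≤-refl
... | inj₂ refl = Int.i≤j⇒i-k≤j 1ℤ (Int.i≤i+j j 1ℤ)

∣i-j∣≡1⇒i-1≤j : ∀ {i j} → ∣ i - j ∣ ≡ 1 → i - 1ℤ ≤ j
∣i-j∣≡1⇒i-1≤j {i} {j} ∣i-j∣≡1 with ∣i-j∣≡1⇒i≡j±1 {i} {j} ∣i-j∣≡1
... | inj₁ refl = Int.≤-reflexive (j+1-1≡j j)
  where j+1-1≡j : ∀ j → j + 1ℤ - 1ℤ ≡ j
        j+1-1≡j = solve-∀
... | inj₂ refl = Int.i≤j⇒i-k≤j 1ℤ (Int.i≤j⇒i-k≤j 1ℤ Int.≤-refl)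

∣i-j∣≡1⇒odd[j]⇒even[i] : ∀ {i j k} → ∣ i - j ∣ ≡ 1 → j + 1ℤ ≡ + 2 * k → ∃ λ e → i ≡ + 2 * e
∣i-j∣≡1⇒odd[j]⇒even[i] {i} {j} {k} ∣i-j∣≡1 j+1≡2k with ∣i-j∣≡1⇒i≡j±1 {i} {j} ∣i-j∣≡1
... | inj₁ refl = k , j+1≡2k
... | inj₂ refl = k - 1ℤ , (begin
  j - 1ℤ              ≡⟨ shift j ⟩
  (j + 1ℤ) - + 2      ≡⟨ cong (_- + 2) j+1≡2k ⟩
  + 2 * k - + 2       ≡⟨ factor k ⟩
  + 2 * (k - 1ℤ)      ∎)
  where
    open ≡-Reasoning
    shift : ∀ j → j - 1ℤ ≡ (j + 1ℤ) - + 2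
    shift = solve-∀
    factor : ∀ k → + 2 * k - + 2 ≡ + 2 * (k - 1ℤ)
    factor = solve-∀

-i-1≤-j⇒j≤i+1 : ∀ {i j} → - i - 1ℤ ≤ - j → j ≤ i + 1ℤ
-i-1≤-j⇒j≤i+1 {i} {j} = Int.neg-cancel-≤ ∘ subst (_≤ - j) (negate-sum i)
  where
    negate-sum : ∀ i → - i - 1ℤ ≡ - (i + 1ℤ)
    negate-sum = solve-∀

≤⇒≡⊎suc≤ : ∀ {i j} → i ≤ j → i ≡ j ⊎ sucℤ i ≤ j
≤⇒≡⊎suc≤ {i} {j} i≤j with i Int.≟ j
... | yes i≡j = inj₁ i≡j
... | no  i≢j = inj₂ (Int.i<j⇒suc[i]≤j (Int.≤∧≢⇒< i≤j i≢j))

within-two-steps : ∀ {s e} → s ≤ e → e ≤ sucℤ (sucℤ s) → e ≡ s ⊎ e ≡ sucℤ s ⊎ e ≡ sucℤ (sucℤ s)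
within-two-steps s≤e e≤s+2 with ≤⇒≡⊎suc≤ s≤e
... | inj₁ s≡e = inj₁ (sym s≡e)
... | inj₂ s+1≤e with ≤⇒≡⊎suc≤ s+1≤e
...   | inj₁ s+1≡e = inj₂ (inj₁ (sym s+1≡e))
...   | inj₂ s+2≤e = inj₂ (inj₂ (Int.≤-antisym e≤s+2 s+2≤e))

even-window : ∀ {a b s e} → a ≡ + 2 * s → b ≡ + 2 * e → a ≤ b → b ≤ a + + 4 →
  b ≡ a ⊎ b ≡ a + + 2 ⊎ b ≡ a + + 4
even-window {s = s} {e} refl refl 2s≤2e 2e≤2s+4 =
  Sum.map (cong (+ 2 *_)) (Sum.map (double-≡ (double-suc s)) (double-≡ (double-suc-suc s)))
    (within-two-steps s≤e e≤s+2)
  where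
    double-≡ : ∀ {t c} → + 2 * t ≡ c → e ≡ t → + 2 * e ≡ c
    double-≡ 2t≡c refl = 2t≡c
    double-suc : ∀ s → + 2 * (1ℤ + s) ≡ + 2 * s + + 2
    double-suc = solve-∀
    double-suc-suc : ∀ s → + 2 * (1ℤ + (1ℤ + s)) ≡ + 2 * s + + 4
    double-suc-suc = solve-∀
    s≤e : s ≤ e
    s≤e = Int.*-cancelˡ-≤-pos s e (+ 2) 2s≤2e
    e≤s+2 : e ≤ sucℤ (sucℤ s)
    e≤s+2 = Int.*-cancelˡ-≤-pos e (sucℤ (sucℤ s)) (+ 2) (subst (+ 2 * e ≤_) (sym (double-suc-suc s)) 2e≤2s+4)

-- Superlevel components of a labelling

StepsByOne : (d : ℕ) → (Cube (dim d) → ℤ) → Set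
StepsByOne d h = ∀ u v → Adj d u v → ∣ h u - h v ∣ ≡ 1

StepsByOne-neg : ∀ {d h} → StepsByOne d h → StepsByOne d (λ x → - h x)
StepsByOne-neg {h = h} h-steps u v u~v = begin
  ∣ - h u - - h v ∣ ≡⟨ cong ∣_∣ (negate (h u) (h v)) ⟩
  ∣ - (h u - h v) ∣ ≡⟨ Int.∣-i∣≡∣i∣ (h u - h v) ⟩
  ∣ h u - h v ∣     ≡⟨ h-steps u v u~v ⟩
  1                 ∎
  where
    open ≡-Reasoning
    negate : ∀ a b → - a - - b ≡ - (a - b)
    negate = solve-∀

MinGood⇒MaxGood-neg : ∀ {d f} → MinGood d f → MaxGood d (λ x → - f x)
MinGood⇒MaxGood-neg minGood K (K⊆Ld , K-linked , boundary<) bad =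
  minGood K (K⊆Ld , K-linked , λ x y x∈K y∈N²K y∉K → Int.neg-cancel-< (boundary< x y x∈K y∈N²K y∉K)) bad

module SuperlevelComponents (d : ℕ) (h f : Cube (dim (suc d)) → ℤ) (h-steps : StepsByOne (suc d) h)
  (h<⇒f< : ∀ {x y} → x ∈ inLd (suc d) → y ∈ inLd (suc d) → h x < h y → f x < f y) where

  open MiddleLevels (suc d)
  open Covers d

  superlevel : ℤ → Subset (suc d)
  superlevel c x = inLd (suc d) x ∧ (c ≤ᵇ h x)

  superlevel⁺ : ∀ {c} x → x ∈ inLd (suc d) → c ≤ h x → x ∈ superlevel c
  superlevel⁺ x x∈Ld c≤hx = ∧-≡true⁺ x∈Ld (T⇒≡true (Int.≤⇒≤ᵇ c≤hx))

  superlevel⁻ : ∀ c x → x ∈ superlevel c → x ∈ inLd (suc d) × c ≤ h x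
  superlevel⁻ c x x∈ with x∈Ld , c≤ᵇhx ← ∧-≡true⁻ x∈ = x∈Ld , Int.≤ᵇ⇒≤ (≡true⇒T c≤ᵇhx)

  superlevel-component-isMax : ∀ {c b} (C : Component (superlevel c) b) →
    MaxComponent (suc d) f (Component.K C)
  superlevel-component-isMax {c} C = K⊆Ld , K-linked , boundary<
    where
      open Component C
      K⊆Ld : SubLd (suc d) K
      K⊆Ld x = proj₁ ∘ superlevel⁻ c x ∘ K⊆T
      boundary< : ∀ x y → x ∈ K → y ∈ N² (suc d) K → K y ≡ false → f y < f x
      boundary< x y x∈K y∈N²K y∉K = h<⇒f< y∈Ld (K⊆Ld x x∈K)
          (Int.<-≤-trans hy<c (proj₂ (superlevel⁻ c x (K⊆T x∈K))))
        where
          y∈Ld = N²-Ld {K} (λ {x} → K⊆Ld x) {y} y∈N²K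
          hy<c = Int.≰⇒> λ c≤hy →
            contradiction (trans (sym (K-closed y∈N²K (superlevel⁺ {c} y y∈Ld c≤hy))) y∉K) λ ()

  large-superlevel-closure : MaxGood (suc d) f → ∀ v → v ∈ inLd-1 (suc d) →
    ∃ λ K → (∀ x → x ∈ K → h v - 1ℤ ≤ h x) × HasLargeClosure K
  large-superlevel-closure maxGood v v∈ =
    K , (λ x → proj₂ ∘ superlevel⁻ (h v - 1ℤ) x ∘ K⊆T) ,
    MaxGood⇒HasLargeClosure maxGood (superlevel-component-isMax {h v - 1ℤ} C)
      (upper-covers⊆⇒half v K v∈ λ {x} → upper-cover∈K x)
    where
      up-step : ∀ x → v ⋖ x → x ∈ inLd (suc d) × Adj (suc d) v x
      up-step x v⋖x = let x∈Ld = ⋖-Ld-1⇒Ld v x v∈ v⋖x in x∈Ld , ⋖⇒Adj v x v∈ x∈Ld v⋖x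
      upper-cover∈T : ∀ x → v ⋖ x → x ∈ superlevel (h v - 1ℤ)
      upper-cover∈T x v⋖x with x∈Ld , v~x ← up-step x v⋖x =
        superlevel⁺ x x∈Ld (∣i-j∣≡1⇒i-1≤j {h v} (h-steps v x v~x))
      x₀ : Cube (dim (suc d))
      x₀ = proj₁ (upper-cover-Ld-1 v v∈)
      v⋖x₀ : v ⋖ x₀
      v⋖x₀ = proj₂ (upper-cover-Ld-1 v v∈)
      C : Component (superlevel (h v - 1ℤ)) x₀
      C = component (superlevel (h v - 1ℤ)) x₀ (upper-cover∈T x₀ v⋖x₀)
      open Component C
      upper-cover∈K : ∀ x → v ⋖ x → x ∈ K
      upper-cover∈K x v⋖x = K-closed
        (N²⁺ K x v x₀ b∈K (proj₂ (up-step x₀ v⋖x₀)) (Adj-sym v x (proj₂ (up-step x v⋖x))))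
        (upper-cover∈T x v⋖x)

minimum-on : ∀ {n} (P : Cube n → Bool) (g : Cube n → ℤ) {x₀} → x₀ ∈ P →
  ∃ λ u → u ∈ P × (∀ v → v ∈ P → g u ≤ g v)
minimum-on {n} P g {x₀} x₀∈P =
  argmin g x₀ candidates ,
  T⇒≡true (argmin-all g (≡true⇒T x₀∈P) (all-filter (T? ∘ P) (allVecs n))) ,
  λ v v∈P → All.lookup (f[argmin]≤f[xs] x₀ candidates)
              (∈-filter⁺ (T? ∘ P) (allVecs-complete v) (≡true⇒T v∈P))
  where candidates = filterᵇ P (allVecs n)

module Labelling (d : ℕ) (h f : Cube (dim (suc d)) → ℤ) (h-steps : StepsByOne (suc d) h)
  (h+1≡2f : ∀ v → v ∈ inLd (suc d) → h v + 1ℤ ≡ + 2 * f v)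
  (maxGood : MaxGood (suc d) f) (minGood : MinGood (suc d) f) where

  open MiddleLevels (suc d)
  open Covers d

  h<⇒f< : ∀ {x y} → x ∈ inLd (suc d) → y ∈ inLd (suc d) → h x < h y → f x < f y
  h<⇒f< {x} {y} x∈ y∈ hx<hy =
    Int.*-cancelˡ-<-nonNeg (+ 2) (subst₂ _<_ (h+1≡2f x x∈) (h+1≡2f y y∈) (Int.+-monoˡ-< 1ℤ hx<hy))

  -h<⇒-f< : ∀ {x y} → x ∈ inLd (suc d) → y ∈ inLd (suc d) → - h x < - h y → - f x < - f y
  -h<⇒-f< x∈ y∈ = Int.neg-mono-< ∘ h<⇒f< y∈ x∈ ∘ Int.neg-cancel-<

  module Above = SuperlevelComponents d h f h-steps h<⇒f<
  -- Minimum components of f are maximum components of -f, so the superlevel argument for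
  -- (-h, -f) yields a large component on which h ≤ h u + 1.
  module Below = SuperlevelComponents d (λ x → - h x) (λ x → - f x) (StepsByOne-neg {h = h} h-steps) -h<⇒-f<

  lower-level-even : ∀ v → v ∈ inLd-1 (suc d) → ∃ λ e → h v ≡ + 2 * e
  lower-level-even v v∈ =
    let x , v⋖x = upper-cover-Ld-1 v v∈
        x∈Ld = ⋖-Ld-1⇒Ld v x v∈ v⋖x
    in ∣i-j∣≡1⇒odd[j]⇒even[i] (h-steps v x (⋖⇒Adj v x v∈ x∈Ld v⋖x)) (h+1≡2f x x∈Ld)

  neighbourhoods-meet⇒bound : ∀ {u v} K₁ K₂ →
    (∀ x → x ∈ K₁ → h v - 1ℤ ≤ h x) → (∀ y → y ∈ K₂ → - h u - 1ℤ ≤ - h y) →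
    ∀ w → w ∈ N (suc d) K₁ → w ∈ N (suc d) K₂ → h v ≤ h u + + 4
  neighbourhoods-meet⇒bound {u} {v} K₁ K₂ K₁-above K₂-below w w∈NK₁ w∈NK₂
    with x , x∈K₁ , w~x ← N⁻ K₁ w w∈NK₁ | y , y∈K₂ , w~y ← N⁻ K₂ w w∈NK₂ = begin
      h v                           ≡⟨ add-sub (h v) ⟩
      (h v - 1ℤ) + 1ℤ               ≤⟨ +1-mono (K₁-above x x∈K₁) ⟩
      h x + 1ℤ                      ≤⟨ +1-mono (∣i-j∣≡1⇒i≤j+1 {h x} {h w} (h-steps x w (Adj-sym w x w~x))) ⟩
      (h w + 1ℤ) + 1ℤ               ≤⟨ +1-mono (+1-mono (∣i-j∣≡1⇒i≤j+1 {h w} {h y} (h-steps w y w~y))) ⟩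
      ((h y + 1ℤ) + 1ℤ) + 1ℤ        ≤⟨ +1-mono (+1-mono (+1-mono (-i-1≤-j⇒j≤i+1 {h u} {h y} (K₂-below y y∈K₂)))) ⟩
      (((h u + 1ℤ) + 1ℤ) + 1ℤ) + 1ℤ ≡⟨ add-four (h u) ⟩
      h u + + 4                     ∎
    where
      open Int.≤-Reasoning
      +1-mono : ∀ {i j} → i ≤ j → i + 1ℤ ≤ j + 1ℤ
      +1-mono = Int.+-monoˡ-≤ 1ℤ
      add-sub : ∀ i → i ≡ (i - 1ℤ) + 1ℤ
      add-sub = solve-∀
      add-four : ∀ i → (((i + 1ℤ) + 1ℤ) + 1ℤ) + 1ℤ ≡ i + + 4
      add-four = solve-∀

  lower-level-width : ∀ u v → u ∈ inLd-1 (suc d) → v ∈ inLd-1 (suc d) → h v ≤ h u + + 4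
  lower-level-width u v u∈ v∈ =
    bound (Above.large-superlevel-closure maxGood v v∈)
          (Below.large-superlevel-closure (MinGood⇒MaxGood-neg minGood) u u∈)
    where
      bound : (∃ λ K → (∀ x → x ∈ K → h v - 1ℤ ≤ h x) × HasLargeClosure K) →
              (∃ λ K → (∀ y → y ∈ K → - h u - 1ℤ ≤ - h y) × HasLargeClosure K) → h v ≤ h u + + 4
      bound (K₁ , K₁-above , K₁-large) (K₂ , K₂-below , K₂-large) =
        let z , z∈[K₁] , z∈[K₂] = large-closures-meet K₁ K₂ K₁-large K₂-large
            w , w∈NK₁ , w∈NK₂ = closures-meet⇒neighbourhoods-meet K₁ K₂ z z∈[K₁] z∈[K₂]
        in neighbourhoods-meet⇒bound K₁ K₂ K₁-above K₂-below w w∈NK₁ w∈NK₂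

lemma7p11 : Σ ℕ λ D → ∀ d → d ≥ D →
    ∀ (v0 : Cube (dim d)) → v0 ∈ inLd-1 d →
    ∀ (h : Cube (dim d) → ℤ) → IsHom d v0 h →
    ∀ (f : Cube (dim d) → ℤ) → (∀ v → v ∈ inLd d → h v + ℤ.pos 1 ≡ ℤ.pos 2 * f v) →
    Legal d f → MaxGood d f → MinGood d f →
    ∃ λ a → ∃ λ b → ∃ λ c → ∀ v → v ∈ inLd-1 d →
      h v ≡ a ⊎ h v ≡ b ⊎ h v ≡ c
lemma7p11 = 1 , λ where
  zero ()
  (suc d) _ v₀ v₀∈ h (_ , h-steps) f h+1≡2f _ maxGood minGood →
    let open Labelling d h f h-steps h+1≡2f maxGood minGood
        u , u∈ , u-min = minimum-on (inLd-1 (suc d)) h {v₀} v₀∈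
        s , hu≡2s = lower-level-even u u∈
    in h u , h u + + 2 , h u + + 4 , λ v v∈ →
         even-window hu≡2s (proj₂ (lower-level-even v v∈)) (u-min v v∈) (lower-level-width u v u∈ v∈)
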